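{- Let $R$ be a ring with $\mathrm{char}(R)\notin\{1,2,3\}$. Then dag-like $\mathrm{Res}_{sw}(\mathrm{lin}_R)$ and tree-like $\mathrm{Res}_{sem}(\mathrm{lin}_R)$ are polynomially bounded refutation systems for unsatisfiable 3-CNFs: every unsatisfiable 3-CNF (viewed as a set of linear clauses) has a refutation in each of these systems of size polynomial in the size of the formula.
   Context: A CNF is viewed as a set of linear clauses over $R$ by writing literal $x$ as $x=1$ and $\neg x$ as $x=0$. A linear clause is a disjunction of linear equations (duplicates identified); variables range over $\{0,1\}$; $\models$ is semantic implication over 0-1 assignments. $\mathrm{Res}_{sw}(\mathrm{lin}_R)$ has the single axiom $0=0$ and the rules resolution (from $C\vee f=0$ and $D\vee g=0$ derive $C\vee D\vee(\alpha f+\beta g=0)$, $\alpha,\beta\in R$) and semantic weakening (from $C$ derive any $D$ with $C\models D$). $\mathrm{Res}_{sem}(\mathrm{lin}_R)$ has the single axiom $0=0$ and only the semantic resolution rule: from $C$ and $C'$ derive any $D$ with $C\wedge C'\models D$. A refutation of $\phi$ is a sequence of clauses ending in the empty clause, each in $\phi$, the axiom, or derived from earlier ones; tree-like means each occurrence of a clause is used at most once as a premise. Size is the total number of variable occurrences plus total size of coefficients. -}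

module Defs where

open import Level using (Level; _⊔_)
open import Algebra.Bundles using (Ring)
open import Data.Nat using (ℕ; zero; suc; _^_; _≤_; _<_; _≟_) renaming (_+_ to _+ℕ_; _*_ to _*ℕ_)
open import Data.Nat.Logarithm using (⌊log₂_⌋)
open import Data.Bool using (Bool; true; false; if_then_else_)
open import Data.List using (List; []; _∷_; _++_; map; length)
open import Data.Nat.ListAction using (sum)
open import Data.List.Relation.Unary.All using (All)
open import Data.List.Relation.Unary.Any using (Any)
open import Data.List.Relation.Unary.Unique.Propositional using (Unique)
open import Data.Fin using (Fin; toℕ)
open import Data.Product using (_×_; _,_; proj₁; proj₂; Σ; ∃; ∃-syntax)
open import Data.Sum using (_⊎_)
open import Relation.Nullary using (¬_; yes; no)
open import Relation.Binary.PropositionalEquality using (_≡_; _≢_)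

-- A literal: (x , true) is x, (x , false) is ¬x.
Literal : Set
Literal = ℕ × Bool

BClause : Set
BClause = List Literal

CNF : Set
CNF = List BClause

Assignment : Set
Assignment = ℕ → Bool

litTrue : Assignment → Literal → Set
litTrue a (x , b) = a x ≡ b

Satisfies : Assignment → CNF → Set
Satisfies a φ = All (λ C → Any (litTrue a) C) φ

Unsatisfiable : CNF → Set
Unsatisfiable φ = ¬ (∃[ a ] Satisfies a φ)

Is3CNF : CNF → Set
Is3CNF φ = All (λ C → length C ≤ 3) φ

module LinR {c ℓ : Level} (R : Ring c ℓ) where
  open Ring R

  _·1 : ℕ → Carrier
  zero  ·1 = 0#
  suc n ·1 = 1# + n ·1

  CharIs : ℕ → Set ℓ
  CharIs n = (n ·1 ≈ 0#) × (∀ m → 0 < m → (n ≡ 0 ⊎ m < n) → ¬ (m ·1 ≈ 0#))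

  -- A linear form  Σ a_i x_i + b  (list of (coefficient , variable) terms
  -- and constant term b); the equation it stands for is  form = 0.
  record LinForm : Set c where
    constructor lf
    field
      terms : List (Carrier × ℕ)
      const : Carrier
  open LinForm public

  WFForm : LinForm → Set
  WFForm f = Unique (map proj₂ (terms f))

  coeffT : List (Carrier × ℕ) → ℕ → Carrier
  coeffT [] x = 0#
  coeffT ((a , y) ∷ ts) x with y ≟ x
  ... | yes _ = a + coeffT ts x
  ... | no  _ = coeffT ts x

  coeff : LinForm → ℕ → Carrier
  coeff f = coeffT (terms f)

  _≈F_ : LinForm → LinForm → Set ℓ
  f ≈F g = (∀ x → coeff f x ≈ coeff g x) × (const f ≈ const g)

  IsComb : Carrier → LinForm → Carrier → LinForm → LinForm → Set ℓ
  IsComb α f β g h =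
    (∀ x → coeff h x ≈ α * coeff f x + β * coeff g x)
    × (const h ≈ α * const f + β * const g)

  -- linear clause: a disjunction of linear equations f = 0
  LClause : Set c
  LClause = List LinForm

  WFClause : LClause → Set c
  WFClause C = All WFForm C

  -- clauses as sets (duplicates identified, forms up to ≈F)
  _⊆C_ : LClause → LClause → Set (c ⊔ ℓ)
  C ⊆C D = All (λ f → Any (λ g → f ≈F g) D) C

  _≈C_ : LClause → LClause → Set (c ⊔ ℓ)
  C ≈C D = (C ⊆C D) × (D ⊆C C)

  val : Bool → Carrier
  val true  = 1#
  val false = 0#

  evalT : Assignment → List (Carrier × ℕ) → Carrier
  evalT a [] = 0#
  evalT a ((k , x) ∷ ts) = k * val (a x) + evalT a ts

  eval : Assignment → LinForm → Carrier
  eval a f = evalT a (terms f) + const f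

  SatC : Assignment → LClause → Set (c ⊔ ℓ)
  SatC a C = Any (λ f → eval a f ≈ 0#) C

  _⊨_ : LClause → LClause → Set (c ⊔ ℓ)
  C ⊨ D = ∀ a → SatC a C → SatC a D

  _∧_⊨_ : LClause → LClause → LClause → Set (c ⊔ ℓ)
  C ∧ C' ⊨ D = ∀ a → SatC a C → SatC a C' → SatC a D

  litForm : Literal → LinForm
  litForm (x , true)  = lf ((1# , x) ∷ []) (- 1#)
  litForm (x , false) = lf ((1# , x) ∷ []) 0#

  toLClause : BClause → LClause
  toLClause C = map litForm C

  toLin : CNF → List LClause
  toLin φ = map toLClause φ

  zeroForm : LinForm
  zeroForm = lf [] 0#

  ResolutionStep : LClause → LClause → LClause → Set (c ⊔ ℓ)
  ResolutionStep P₁ P₂ Q =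
    Σ LinForm λ f → Σ LinForm λ g → Σ LClause λ C → Σ LClause λ D →
    Σ Carrier λ α → Σ Carrier λ β → Σ LinForm λ h →
      (P₁ ≈C (f ∷ C)) × (P₂ ≈C (g ∷ D)) × IsComb α f β g h
      × (Q ≈C (h ∷ C ++ D))

  -- justifications of a line; premises are indices of earlier lines
  data Just : Set where
    hyp  : Just
    axm  : Just
    rule1 : ℕ → Just
    rule2 : ℕ → ℕ → Just

  premises : Just → List ℕ
  premises hyp = []
  premises axm = []
  premises (rule1 j) = j ∷ []
  premises (rule2 j k) = j ∷ k ∷ []

  Line : Set c
  Line = LClause × Just

  take' : ℕ → List Line → List Line
  take' zero ls = []
  take' (suc i) [] = []
  take' (suc i) (l ∷ ls) = l ∷ take' i ls

  At : List Line → ℕ → LClause → Set c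
  At [] j C = Data.Empty.Polymorphic.⊥ where import Data.Empty.Polymorphic
  At (l ∷ ls) zero C = proj₁ l ≡ C
  At (l ∷ ls) (suc j) C = At ls j C

  data System : Set where
    sw  : System
    sem : System

  ValidLine : System → List LClause → List Line → Line → Set (c ⊔ ℓ)
  ValidLine s φ prev (Q , hyp) = Any (λ P → Q ≈C P) φ
  ValidLine s φ prev (Q , axm) = Q ≈C (zeroForm ∷ [])
  ValidLine sw φ prev (Q , rule1 j) =
    Σ LClause λ P → At prev j P × (P ⊨ Q)
  ValidLine sw φ prev (Q , rule2 j k) =
    Σ LClause λ P₁ → Σ LClause λ P₂ →
      At prev j P₁ × At prev k P₂ × ResolutionStep P₁ P₂ Q
  ValidLine sem φ prev (Q , rule1 j) = Data.Empty.Polymorphic.⊥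
    where import Data.Empty.Polymorphic
  ValidLine sem φ prev (Q , rule2 j k) =
    Σ LClause λ P₁ → Σ LClause λ P₂ →
      At prev j P₁ × At prev k P₂ × (P₁ ∧ P₂ ⊨ Q)

  ValidFrom : System → List LClause → List Line → List Line → Set (c ⊔ ℓ)
  ValidFrom s φ prev [] = Data.Unit.Polymorphic.⊤ where import Data.Unit.Polymorphic
  ValidFrom s φ prev (l ∷ ls) =
    ValidLine s φ prev l × ValidFrom s φ (prev ++ (l ∷ [])) ls

  lastIsEmpty : List Line → Set c
  lastIsEmpty [] = Data.Empty.Polymorphic.⊥ where import Data.Empty.Polymorphic
  lastIsEmpty (l ∷ []) = proj₁ l ≡ []
  lastIsEmpty (l ∷ l' ∷ ls) = lastIsEmpty (l' ∷ ls)

  count : ℕ → List ℕ → ℕ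
  count j [] = 0
  count j (k ∷ ks) with j ≟ k
  ... | yes _ = suc (count j ks)
  ... | no  _ = count j ks

  allPremises : List Line → List ℕ
  allPremises [] = []
  allPremises ((_ , J) ∷ ls) = premises J ++ allPremises ls

  TreeLike : List Line → Set
  TreeLike π = ∀ j → count j (allPremises π) ≤ 1

  Refutation : System → List LClause → List Line → Set (c ⊔ ℓ)
  Refutation s φ π =
    All (λ l → WFClause (proj₁ l)) π × ValidFrom s φ [] π × lastIsEmpty π

  module Size (csize : Carrier → ℕ) where
    formSize : LinForm → ℕ
    formSize f = length (terms f) +ℕ sum (map (λ t → csize (proj₁ t)) (terms f))
                 +ℕ csize (const f)

    clauseSize : LClause → ℕ
    clauseSize C = sum (map formSize C)

    setSize : List LClause → ℕ
    setSize φ = sum (map clauseSize φ)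

    proofSize : List Line → ℕ
    proofSize π = sum (map (λ l → clauseSize (proj₁ l)) π)

    PolyBounded : System → Bool → Set (c ⊔ ℓ)
    PolyBounded s tree = ∃[ K ] ∃[ d ] ∀ (φ : CNF) → Is3CNF φ → Unsatisfiable φ →
      Σ (List Line) λ π → Refutation s (toLin φ) π
        × (if tree then TreeLike π else Data.Unit.Polymorphic.⊤)
        × proofSize π ≤ K *ℕ (suc (setSize (toLin φ))) ^ d
      where import Data.Unit.Polymorphic

  BinaryIntSize : (Carrier → ℕ) → Set
  BinaryIntSize csize = ∃[ k ] ∀ n →
    (csize (n ·1) ≤ k *ℕ suc ⌊log₂ n ⌋) × (csize (- (n ·1)) ≤ k *ℕ suc ⌊log₂ n ⌋)

-- The counting form N_C = Σ_{x ∈ C} x + Σ_{¬x ∈ C} (1 − x) of a clause C (repeated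
-- variables merged; the constant 1 for a tautology) evaluates to the number t ≤ 3 of
-- true literals of C, so N_C = 0 iff C is falsified, and t·1 ≠ 0 otherwise since
-- char(R) ∉ {1, 2, 3}.  For unsatisfiable φ the clause {N_C = 0 : C ∈ φ} is therefore
-- a tautology, obtained from the axiom 0 = 0 in one step; its disjuncts are then removed
-- one clause C at a time: in Res_sem by semantic resolution with the hypothesis C, in
-- Res_sw by weakening C to {N_C − k = 0 : k = 1, 2, 3} and eliminating these three
-- disjuncts by resolution against N_C = 0 (leaving the false k = 0) and weakening.

module Submission where

open import Defs
open import Level using (Level; 0ℓ)
open import Algebra.Bundles using (Ring)
open import Data.Bool using (Bool; true; false; not)
import Data.Bool.Properties as Bool
open import Data.Empty using (⊥-elim)
open import Data.List using (List; []; _∷_; _++_; map; length; filter; deduplicate)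
open import Data.List.Properties
  using (map-++; length-map; length-++; ++-identityʳ; ++-assoc; length-filter; filter-some; filter-none;
         length-deduplicate)
open import Data.List.Membership.Propositional using (_∈_; find; lose)
open import Data.List.Membership.Propositional.Properties using (∈-deduplicate⁻)
open import Data.List.Relation.Unary.All as All using (All; []; _∷_)
import Data.List.Relation.Unary.All.Properties as All
open import Data.List.Relation.Unary.AllPairs using (AllPairs; []; _∷_)
import Data.List.Relation.Unary.AllPairs.Properties as AllPairs
open import Data.List.Relation.Unary.Any as Any using (Any; here; there; any?)
import Data.List.Relation.Unary.Any.Properties as Any
open import Data.List.Relation.Unary.Unique.DecSetoid.Properties using (deduplicate-!)
open import Data.Nat using (ℕ; zero; suc; _+_; _*_; _^_; _∸_; _≤_; _<_; z≤n; s≤s; _≟_; _≤?_)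
import Data.Nat.Properties as ℕ
open import Data.Nat.Properties
  using (≡-decSetoid; ≤-refl; ≤-reflexive; ≤-trans; <⇒≤; ≰⇒>; <-irrefl; n≤1+n; n<1+n; m<n⇒m<1+n;
         m≤n⇒m≤1+n; m≤n⇒m<n∨m≡n; m≤m+n; m≤n+m; m≤m*n; m∸n≤m; m∸n+n≡m; m+[n∸m]≡n;
         +-mono-≤; +-monoʳ-≤; *-mono-≤; *-monoˡ-≤; *-monoʳ-≤)
open import Data.Nat.ListAction using (sum)
open import Data.Nat.ListAction.Properties using (sum-++)
open import Data.Nat.Logarithm using (⌊log₂_⌋; ⌊log₂⌋-mono-≤)
open import Data.Nat.Tactic.RingSolver using (solve-∀)
open import Data.Product using (_×_; _,_; proj₁; proj₂; Σ; ∃; ∃-syntax)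
import Data.Product.Properties as Product
open import Data.Sum using (_⊎_; inj₁; inj₂)
import Data.Unit.Polymorphic
open import Relation.Binary.Bundles using (DecSetoid)
import Relation.Binary.Construct.On as On
open import Relation.Binary.PropositionalEquality as ≡ using (_≡_; _≢_; refl)
open import Relation.Nullary using (¬_; Dec; yes; no)
open import Data.List.Membership.DecPropositional (Product.≡-dec _≟_ Bool._≟_) using (_∈?_)

var : Literal → ℕ
var = proj₁

flipLit : Literal → Literal
flipLit (x , b) = x , not b

Tautology : BClause → Set
Tautology C = Any (λ l → flipLit l ∈ C) C

tautology? : ∀ C → Dec (Tautology C)
tautology? C = any? (λ l → flipLit l ∈? C) C

litTrue? : ∀ a l → Dec (litTrue a l)
litTrue? a (x , b) = a x Bool.≟ b

clauseSat? : ∀ a C → Dec (Any (litTrue a) C)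
clauseSat? a = any? (litTrue? a)

tautology-sat : ∀ a {C} → Tautology C → Any (litTrue a) C
tautology-sat a taut with find taut
... | (x , b) , l∈C , l̄∈C with a x Bool.≟ b
...   | yes ax≡b = lose l∈C ax≡b
...   | no  ax≢b = lose l̄∈C (Bool.¬-not ax≢b)

nonTautology-sameVar : ∀ {C} → ¬ Tautology C →
                       ∀ {l m} → l ∈ C → m ∈ C → var l ≡ var m → l ≡ m
nonTautology-sameVar {C} nt {x , b} {.x , b′} l∈C m∈C refl with b Bool.≟ b′
... | yes b≡b′ = ≡.cong (x ,_) b≡b′
... | no  b≢b′ = ⊥-elim (nt (lose l∈C m̄∈C))
  where
  m̄∈C : (x , not b) ∈ C
  m̄∈C = ≡.subst (λ b″ → (x , b″) ∈ C) (Bool.¬-not (λ e → b≢b′ (≡.sym e))) m∈C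

VarSetoid : DecSetoid 0ℓ 0ℓ
VarSetoid = On.decSetoid ≡-decSetoid var

_≟ᵥ_ : ∀ l m → Dec (var l ≡ var m)
_≟ᵥ_ = DecSetoid._≟_ VarSetoid

-- Keep the first literal of each variable.  For a non-tautological clause this
-- preserves the satisfying assignments and makes the variables distinct.
normalise : BClause → BClause
normalise = deduplicate _≟ᵥ_

normalise-distinct : ∀ C → AllPairs (λ l m → var l ≢ var m) (normalise C)
normalise-distinct = deduplicate-! VarSetoid

normalise-length : ∀ C → length (normalise C) ≤ length C
normalise-length = length-deduplicate _≟ᵥ_

-- A true literal m of a non-tautological clause survives normalisation: the literal
-- kept for its variable is m itself.
normalise-sat : ∀ a {C} → ¬ Tautology C → Any (litTrue a) C → Any (litTrue a) (normalise C)
normalise-sat a {C} nt sat with find sat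
... | m , m∈C , m-true = representative (find (Any.deduplicate⁺ _≟ᵥ_ ≡.trans m′∈C))
  where
  m′∈C : Any (λ l → var l ≡ var m) C
  m′∈C = Any.map (λ m≡l → ≡.cong var (≡.sym m≡l)) m∈C
  representative : ∃ (λ l → l ∈ normalise C × var l ≡ var m) → Any (litTrue a) (normalise C)
  representative (l , l∈N , l~m) =
    lose l∈N (≡.subst (litTrue a) (≡.sym l≡m) m-true)
    where
    l≡m : l ≡ m
    l≡m = nonTautology-sameVar nt (∈-deduplicate⁻ _≟ᵥ_ C l∈N) m∈C l~m

trueCount : Assignment → List Literal → ℕ
trueCount a L = length (filter (litTrue? a) L)

-- The value of the counting form of a clause under an assignment: the number of
-- distinct true literals, or 1 for a tautology.
truth : Assignment → BClause → ℕ
truth a C with tautology? C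
... | yes _ = 1
... | no  _ = trueCount a (normalise C)

truth-≤ : ∀ a C → truth a C ≤ length C
truth-≤ a C with tautology? C
... | yes (here _)  = s≤s z≤n
... | yes (there _) = s≤s z≤n
... | no  _         = ≤-trans (length-filter (litTrue? a) (normalise C)) (normalise-length C)

truth-pos : ∀ a C → Any (litTrue a) C → 0 < truth a C
truth-pos a C sat with tautology? C
... | yes _  = s≤s z≤n
... | no  nt = filter-some (litTrue? a) (normalise-sat a nt sat)

truth-zero : ∀ a C → ¬ Any (litTrue a) C → truth a C ≡ 0
truth-zero a C unsat with tautology? C
... | yes taut = ⊥-elim (unsat (tautology-sat a taut))
... | no  _    = ≡.cong length (filter-none (litTrue? a) (All.¬Any⇒All¬ _ (λ s → unsat (Any.deduplicate⁻ _ s))))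

module _ {c ℓ : Level} (R : Ring c ℓ) where

  open Ring R using (Carrier; 0#; 1#; _≈_; setoid; +-assoc; +-comm; +-identityˡ; +-identityʳ;
    -‿inverseˡ; -‿inverseʳ; *-identityˡ; *-identityʳ; zeroʳ; +-cong; -‿cong; +-congˡ; +-congʳ;
    +-commutativeSemigroup)
    renaming (_+_ to _⊕_; _*_ to _⊛_; -_ to ⊝_; refl to ≈-refl; sym to ≈-sym; trans to ≈-trans;
              reflexive to ≈-reflexive)
  open import Algebra.Properties.Ring R using (-1*x≈-x; +-identityˡ-unique)
  open import Algebra.Properties.CommutativeSemigroup +-commutativeSemigroup using (interchange)
  open import Relation.Binary.Reasoning.Setoid setoid
  open LinR R

  ·1-+ : ∀ m n → (m + n) ·1 ≈ m ·1 ⊕ n ·1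
  ·1-+ zero    n = ≈-sym (+-identityˡ _)
  ·1-+ (suc m) n = begin
    1# ⊕ (m + n) ·1      ≈⟨ +-congˡ (·1-+ m n) ⟩
    1# ⊕ (m ·1 ⊕ n ·1)   ≈⟨ ≈-sym (+-assoc _ _ _) ⟩
    (1# ⊕ m ·1) ⊕ n ·1   ∎

  -- If no characteristic lies in 1..N, then t·1 ≉ 0 for 0 < t ≤ N: a least t with
  -- t·1 ≈ 0 would be the characteristic.  (Induction on a bound b for t.)
  multiples-nonzero : ∀ N → (∀ n → 0 < n → n ≤ N → ¬ CharIs n) →
                      ∀ t → 0 < t → t ≤ N → ¬ (t ·1 ≈ 0#)
  multiples-nonzero N noChar t 0<t t≤N = upTo t t 0<t ≤-refl t≤N
    where
    upTo : ∀ b t → 0 < t → t ≤ b → b ≤ N → ¬ (t ·1 ≈ 0#)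
    upTo zero    (suc _) _ () _
    upTo (suc b) t 0<t t≤b b≤N with m≤n⇒m<n∨m≡n t≤b
    ... | inj₁ (s≤s t≤b′) = upTo b t 0<t t≤b′ (≤-trans (n≤1+n b) b≤N)
    ... | inj₂ refl = λ t·1≈0 → noChar t 0<t b≤N (t·1≈0 , smaller)
      where
      smaller : ∀ m → 0 < m → (t ≡ 0 ⊎ m < t) → ¬ (m ·1 ≈ 0#)
      smaller m 0<m (inj₂ (s≤s m≤b)) = upTo b m 0<m m≤b (≤-trans (n≤1+n b) b≤N)

  smallMultiples-nonzero : (∀ n → CharIs n → (n ≢ 1) × (n ≢ 2) × (n ≢ 3)) →
                           ∀ t → 0 < t → t ≤ 3 → ¬ (t ·1 ≈ 0#)
  smallMultiples-nonzero char∉123 = multiples-nonzero 3 noSmallChar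
    where
    noSmallChar : ∀ n → 0 < n → n ≤ 3 → ¬ CharIs n
    noSmallChar 1 _ _ char1 = proj₁ (char∉123 1 char1) refl
    noSmallChar 2 _ _ char2 = proj₁ (proj₂ (char∉123 2 char2)) refl
    noSmallChar 3 _ _ char3 = proj₂ (proj₂ (char∉123 3 char3)) refl
    noSmallChar (suc (suc (suc (suc _)))) _ (s≤s (s≤s (s≤s ())))

  -- (p − q)·1, written as ± a natural multiple of 1 so that its size stays controlled.
  diff·1 : ℕ → ℕ → Carrier
  diff·1 p q with q ≤? p
  ... | yes _ = (p ∸ q) ·1
  ... | no  _ = ⊝ ((q ∸ p) ·1)

  diff·1-correct : ∀ p q → diff·1 p q ⊕ q ·1 ≈ p ·1
  diff·1-correct p q with q ≤? p
  ... | yes q≤p = ≈-trans (≈-sym (·1-+ (p ∸ q) q)) (≈-reflexive (≡.cong _·1 (m∸n+n≡m q≤p)))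
  ... | no  q≰p = begin
    ⊝ d ⊕ q ·1                ≈⟨ +-congˡ (≈-reflexive (≡.cong _·1 (≡.sym (m+[n∸m]≡n (<⇒≤ (≰⇒> q≰p)))))) ⟩
    ⊝ d ⊕ (p + (q ∸ p)) ·1    ≈⟨ +-congˡ (≈-trans (·1-+ p (q ∸ p)) (+-comm _ _)) ⟩
    ⊝ d ⊕ (d ⊕ p ·1)          ≈⟨ ≈-sym (+-assoc _ _ _) ⟩
    (⊝ d ⊕ d) ⊕ p ·1          ≈⟨ +-congʳ (-‿inverseˡ d) ⟩
    0# ⊕ p ·1                 ≈⟨ +-identityˡ _ ⟩
    p ·1                      ∎
    where d = (q ∸ p) ·1

  sign : Bool → Carrier
  sign true  = 1 ·1
  sign false = ⊝ (1 ·1)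

  litTerm : Literal → Carrier × ℕ
  litTerm (x , b) = sign b , x

  negatives : List Literal → ℕ
  negatives []                = 0
  negatives ((_ , true)  ∷ L) = negatives L
  negatives ((_ , false) ∷ L) = suc (negatives L)

  regroup : ∀ {s e o n v w} → s ⊕ o ≈ v → e ⊕ n ≈ w → (s ⊕ e) ⊕ (o ⊕ n) ≈ v ⊕ w
  regroup so≈v en≈w = ≈-trans (interchange _ _ _ _) (+-cong so≈v en≈w)

  ≈0+ : ∀ {x} → x ≈ 0# ⊕ x
  ≈0+ = ≈-sym (+-identityˡ _)

  1·1≈1 : 1 ·1 ≈ 1#
  1·1≈1 = +-identityʳ 1#

  oneTerm : ∀ v c → ((1# ⊛ v) ⊕ 0#) ⊕ c ≈ v ⊕ c
  oneTerm v c = +-congʳ (≈-trans (+-identityʳ _) (*-identityˡ v))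

  -- Σ_{l ∈ L} (±x_l) + #negatives evaluates to the number of true literals of L: each
  -- literal contributes its term plus 1 if it is negative, i.e. 1 if true and 0 if false.
  countLits-value : ∀ a L → evalT a (map litTerm L) ⊕ negatives L ·1 ≈ trueCount a L ·1
  countLits-value a [] = +-identityˡ 0#
  countLits-value a ((x , b) ∷ L) with a x | b | countLits-value a L
  ... | true  | true  | ih = ≈-trans (+-congˡ ≈0+) (regroup positive-true ih)
    where
    positive-true : (1 ·1 ⊛ 1#) ⊕ 0# ≈ 1#
    positive-true = ≈-trans (+-identityʳ _) (≈-trans (*-identityʳ _) 1·1≈1)
  ... | false | true  | ih = ≈-trans (+-congˡ ≈0+) (≈-trans (regroup positive-false ih) (+-identityˡ _))
    where
    positive-false : (1 ·1 ⊛ 0#) ⊕ 0# ≈ 0#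
    positive-false = ≈-trans (+-identityʳ _) (zeroʳ _)
  ... | true  | false | ih = ≈-trans (regroup negative-false ih) (+-identityˡ _)
    where
    negative-false : (⊝ (1 ·1) ⊛ 1#) ⊕ 1# ≈ 0#
    negative-false = ≈-trans (+-congʳ (≈-trans (*-identityʳ _) (-‿cong 1·1≈1))) (-‿inverseˡ 1#)
  ... | false | false | ih = regroup negative-true ih
    where
    negative-true : (⊝ (1 ·1) ⊛ 0#) ⊕ 1# ≈ 1#
    negative-true = ≈-trans (+-congʳ (zeroʳ _)) (+-identityˡ 1#)

  countedLits : BClause → List Literal
  countedLits C with tautology? C
  ... | yes _ = []
  ... | no  _ = normalise C

  countOffset : BClause → ℕ
  countOffset C with tautology? C
  ... | yes _ = 1
  ... | no  _ = negatives (normalise C)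

  countForm : BClause → LinForm
  countForm C = lf (map litTerm (countedLits C)) (countOffset C ·1)

  shiftForm : ℕ → BClause → LinForm
  shiftForm k C = lf (map litTerm (countedLits C)) (diff·1 (countOffset C) k)

  shiftForms : BClause → LClause
  shiftForms C = shiftForm 1 C ∷ shiftForm 2 C ∷ shiftForm 3 C ∷ []

  constForm : ℕ → LinForm
  constForm k = lf [] (k ·1)

  countForm-value : ∀ a C → eval a (countForm C) ≈ truth a C ·1
  countForm-value a C with tautology? C
  ... | yes _ = +-identityˡ _
  ... | no  _ = countLits-value a (normalise C)

  shiftForm-value : ∀ a k C → eval a (shiftForm k C) ⊕ k ·1 ≈ eval a (countForm C)
  shiftForm-value a k C = ≈-trans (+-assoc _ _ _) (+-congˡ (diff·1-correct (countOffset C) k))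

  -- countForm C − shiftForm k C = constForm k: the resolution step eliminating shiftForm k C.
  shiftForm-comb : ∀ k C → IsComb 1# (countForm C) (⊝ 1#) (shiftForm k C) (constForm k)
  shiftForm-comb k C = (λ x → ≈-sym (cancel (coeffT (map litTerm (countedLits C)) x))) , constant
    where
    cancel : ∀ a → 1# ⊛ a ⊕ ⊝ 1# ⊛ a ≈ 0#
    cancel a = ≈-trans (+-cong (*-identityˡ a) (-1*x≈-x a)) (-‿inverseʳ a)
    o d : Carrier
    o = countOffset C ·1
    d = diff·1 (countOffset C) k
    constant : k ·1 ≈ 1# ⊛ o ⊕ ⊝ 1# ⊛ d
    constant = ≈-sym (begin
      1# ⊛ o ⊕ ⊝ 1# ⊛ d   ≈⟨ +-cong (≈-trans (*-identityˡ o) (≈-sym (diff·1-correct (countOffset C) k))) (-1*x≈-x d) ⟩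
      (d ⊕ k ·1) ⊕ ⊝ d    ≈⟨ +-congʳ (+-comm d _) ⟩
      (k ·1 ⊕ d) ⊕ ⊝ d    ≈⟨ +-assoc _ _ _ ⟩
      k ·1 ⊕ (d ⊕ ⊝ d)    ≈⟨ +-congˡ (-‿inverseʳ d) ⟩
      k ·1 ⊕ 0#           ≈⟨ +-identityʳ _ ⟩
      k ·1                ∎)

  countForm-wf : ∀ C → WFForm (countForm C)
  countForm-wf C with tautology? C
  ... | yes _ = []
  ... | no  _ = AllPairs.map⁺ (AllPairs.map⁺ (normalise-distinct C))

  shiftForm-wf : ∀ k C → WFForm (shiftForm k C)
  shiftForm-wf k C = countForm-wf C

  countForms-wf : ∀ ψ → All WFForm (map countForm ψ)
  countForms-wf ψ = All.map⁺ (All.universal countForm-wf ψ)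

  toLClause-wf : ∀ C → WFClause (toLClause C)
  toLClause-wf C = All.map⁺ (All.universal litForm-wf C)
    where
    litForm-wf : ∀ l → WFForm (litForm l)
    litForm-wf (x , true)  = [] ∷ []
    litForm-wf (x , false) = [] ∷ []

  countForm-unsat : ∀ a C → ¬ Any (litTrue a) C → eval a (countForm C) ≈ 0#
  countForm-unsat a C unsat = ≈-trans (countForm-value a C) (≈-reflexive (≡.cong _·1 (truth-zero a C unsat)))

  unsat-countForms : ∀ φ → Unsatisfiable φ → ∀ a → SatC a (map countForm φ)
  unsat-countForms φ unsat a with All.all? (clauseSat? a) φ
  ... | yes sat = ⊥-elim (unsat (a , sat))
  ... | no ¬sat = Any.map⁺ (Any.map (countForm-unsat a _) (All.¬All⇒Any¬ (clauseSat? a) φ ¬sat))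

  -- A satisfied 3-clause has between 1 and 3 true literals, so one of its shift forms vanishes.
  shiftForms-cover : ∀ a C → length C ≤ 3 → Any (litTrue a) C → SatC a (shiftForms C)
  shiftForms-cover a C len sat = pick (truth a C) (truth-pos a C sat) (≤-trans (truth-≤ a C) len) (countForm-value a C)
    where
    vanishes : ∀ k → eval a (countForm C) ≈ k ·1 → eval a (shiftForm k C) ≈ 0#
    vanishes k e = +-identityˡ-unique _ _ (≈-trans (shiftForm-value a k C) e)
    pick : ∀ t → 0 < t → t ≤ 3 → eval a (countForm C) ≈ t ·1 → SatC a (shiftForms C)
    pick 1 _ _ e = here (vanishes 1 e)
    pick 2 _ _ e = there (here (vanishes 2 e))
    pick 3 _ _ e = there (there (here (vanishes 3 e)))
    pick (suc (suc (suc (suc _)))) _ (s≤s (s≤s (s≤s ()))) _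

  module Semantics (nonzero : ∀ t → 0 < t → t ≤ 3 → ¬ (t ·1 ≈ 0#)) where

    1≉0 : ¬ (1# ≈ 0#)
    1≉0 1≈0 = nonzero 1 (s≤s z≤n) (s≤s z≤n) (≈-trans 1·1≈1 1≈0)

    litForm-sound : ∀ a l → eval a (litForm l) ≈ 0# → litTrue a l
    litForm-sound a (x , true) e with a x | ≈-trans (≈-sym (oneTerm _ _)) e
    ... | true  | _     = refl
    ... | false | 0-1≈0 = ⊥-elim (1≉0 (begin
      1#          ≈⟨ ≈-sym (+-identityʳ 1#) ⟩
      1# ⊕ 0#     ≈⟨ +-congˡ (≈-trans (≈-sym (+-identityˡ _)) 0-1≈0) ⟨
      1# ⊕ ⊝ 1#   ≈⟨ -‿inverseʳ 1# ⟩
      0#          ∎))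
    litForm-sound a (x , false) e with a x | ≈-trans (≈-sym (oneTerm _ _)) e
    ... | false | _     = refl
    ... | true  | 1+0≈0 = ⊥-elim (1≉0 (≈-trans (≈-sym (+-identityʳ 1#)) 1+0≈0))

    toLClause-sound : ∀ a C → SatC a (toLClause C) → Any (litTrue a) C
    toLClause-sound a C sat = Any.map (litForm-sound a _) (Any.map⁻ sat)

    countForm-sat : ∀ a C → length C ≤ 3 → Any (litTrue a) C → ¬ (eval a (countForm C) ≈ 0#)
    countForm-sat a C len sat e =
      nonzero (truth a C) (truth-pos a C sat) (≤-trans (truth-≤ a C) len) (≈-trans (≈-sym (countForm-value a C)) e)

    constForm-false : ∀ a k → 0 < k → k ≤ 3 → ¬ (eval a (constForm k) ≈ 0#)
    constForm-false a k 0<k k≤3 e = nonzero k 0<k k≤3 (≈-trans ≈0+ e)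

  ≈C-refl : ∀ C → C ≈C C
  ≈C-refl C = ⊆-refl , ⊆-refl
    where
    ⊆-refl : C ⊆C C
    ⊆-refl = All.tabulate (Any.map (λ { refl → (λ _ → ≈-refl) , ≈-refl }))

  weaken-drop : ∀ f C D → (∀ a → ¬ (eval a f ≈ 0#)) → (f ∷ C ++ (D ++ C)) ⊨ (D ++ C)
  weaken-drop f C D never a (here e)  = ⊥-elim (never a e)
  weaken-drop f C D never a (there s) with Any.++⁻ C s
  ... | inj₁ sC  = Any.++⁺ʳ D sC
  ... | inj₂ sDC = sDC

  at-++ˡ : ∀ X {Y j P} → At X j P → At (X ++ Y) j P
  at-++ˡ (_ ∷ X) {j = zero}  at = at
  at-++ˡ (_ ∷ X) {j = suc j} at = at-++ˡ X at

  at-++ʳ : ∀ X {Y j P} → At Y j P → At (X ++ Y) (length X + j) P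
  at-++ʳ []      at = at
  at-++ʳ (_ ∷ X) at = at-++ʳ X at

  validFrom-++ : ∀ {s Φ} X xs ys → ValidFrom s Φ X xs → ValidFrom s Φ (X ++ xs) ys →
                 ValidFrom s Φ X (xs ++ ys)
  validFrom-++ {s} {Φ} X [] ys _ valid = ≡.subst (λ Z → ValidFrom s Φ Z ys) (++-identityʳ X) valid
  validFrom-++ {s} {Φ} X (x ∷ xs) ys (v , vs) valid =
    v , validFrom-++ (X ++ x ∷ []) xs ys vs
          (≡.subst (λ Z → ValidFrom s Φ Z ys) (≡.sym (++-assoc X (x ∷ []) xs)) valid)

  Cursor : List Line → ℕ → LClause → Set c
  Cursor X i P = length X ≡ suc i × At X i P

  cursor-++ : ∀ X Y {i P d Q} → Cursor X i P → At Y d Q → length Y ≡ suc d → Cursor (X ++ Y) (d + suc i) Q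
  cursor-++ X Y {i} {d = d} {Q} (lenX , _) atY lenY =
    ≡.trans (length-++ X) (≡.trans (≡.cong₂ _+_ lenX lenY) (ℕ.+-comm (suc i) (suc d))) ,
    ≡.subst (λ j → At (X ++ Y) j Q) (≡.trans (≡.cong (_+ d) lenX) (ℕ.+-comm (suc i) d)) (at-++ʳ X atY)

  cursor-last : ∀ π {i} → Cursor π i [] → lastIsEmpty π
  cursor-last (l ∷ [])     (refl , at) = at
  cursor-last (l ∷ l′ ∷ π) (refl , at) = cursor-last (l′ ∷ π) (refl , at)

  data Consecutive : ℕ → List ℕ → Set where
    done : ∀ {i} → Consecutive i []
    next : ∀ {i xs} → Consecutive (suc i) xs → Consecutive i (i ∷ xs)

  consecutive-below : ∀ {i xs j} → Consecutive i xs → j < i → count j xs ≡ 0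
  consecutive-below done _ = refl
  consecutive-below {i} {j = j} (next run) j<i with j ≟ i
  ... | yes refl = ⊥-elim (<-irrefl refl j<i)
  ... | no  _    = consecutive-below run (m<n⇒m<1+n j<i)

  consecutive-once : ∀ {i xs} → Consecutive i xs → ∀ j → count j xs ≤ 1
  consecutive-once done j = z≤n
  consecutive-once {i} (next run) j with j ≟ i
  ... | yes refl = ≤-reflexive (≡.cong suc (consecutive-below run (n<1+n j)))
  ... | no  _    = consecutive-once run j

  IntSizeBound : (Carrier → ℕ) → ℕ → Set
  IntSizeBound csize k = ∀ n → csize (n ·1) ≤ k * suc ⌊log₂ n ⌋ × csize (⊝ (n ·1)) ≤ k * suc ⌊log₂ n ⌋

  module FormSizes (csize : Carrier → ℕ) (k : ℕ) (intSize : IntSizeBound csize k) where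
    open Size csize

    -- Every form used has at most 3 terms with coefficients ±1 and a constant in −3..3.
    A : ℕ
    A = 3 * suc k + k * 2

    small-log : ∀ {n} → n ≤ 3 → k * suc ⌊log₂ n ⌋ ≤ k * 2
    small-log n≤3 = *-monoʳ-≤ k (s≤s (⌊log₂⌋-mono-≤ n≤3))

    small-pos : ∀ {n} → n ≤ 3 → csize (n ·1) ≤ k * 2
    small-pos {n} n≤3 = ≤-trans (proj₁ (intSize n)) (small-log n≤3)

    small-neg : ∀ {n} → n ≤ 3 → csize (⊝ (n ·1)) ≤ k * 2
    small-neg {n} n≤3 = ≤-trans (proj₂ (intSize n)) (small-log n≤3)

    diff-size : ∀ {p q} → p ≤ 3 → q ≤ 3 → csize (diff·1 p q) ≤ k * 2
    diff-size {p} {q} p≤3 q≤3 with q ≤? p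
    ... | yes _ = small-pos (≤-trans (m∸n≤m p q) p≤3)
    ... | no  _ = small-neg (≤-trans (m∸n≤m q p) q≤3)

    sign-size : ∀ b → csize (sign b) ≤ k
    sign-size true  = ≤-trans (proj₁ (intSize 1)) (≤-reflexive (ℕ.*-identityʳ k))
    sign-size false = ≤-trans (proj₂ (intSize 1)) (≤-reflexive (ℕ.*-identityʳ k))

    TermsSize : List (Carrier × ℕ) → ℕ
    TermsSize ts = length ts + sum (map (λ t → csize (proj₁ t)) ts)

    litTerms-size : ∀ L → TermsSize (map litTerm L) ≤ length L * suc k
    litTerms-size []            = z≤n
    litTerms-size ((x , b) ∷ L) = ≤-trans (≤-reflexive (regroupℕ (length (map litTerm L)) _ (csize (sign b))))
                                          (+-mono-≤ (s≤s (sign-size b)) (litTerms-size L))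
      where
      regroupℕ : ∀ m s c → suc (m + (c + s)) ≡ suc c + (m + s)
      regroupℕ = solve-∀

    countedLits-length : ∀ C → length (countedLits C) ≤ length C
    countedLits-length C with tautology? C
    ... | yes _ = z≤n
    ... | no  _ = normalise-length C

    countOffset-≤ : ∀ C → length C ≤ 3 → countOffset C ≤ 3
    countOffset-≤ C len with tautology? C
    ... | yes _ = s≤s z≤n
    ... | no  _ = ≤-trans (negatives-≤ (normalise C)) (≤-trans (normalise-length C) len)
      where
      negatives-≤ : ∀ L → negatives L ≤ length L
      negatives-≤ []                = z≤n
      negatives-≤ ((_ , true)  ∷ L) = m≤n⇒m≤1+n (negatives-≤ L)
      negatives-≤ ((_ , false) ∷ L) = s≤s (negatives-≤ L)

    countedTerms-size : ∀ C → length C ≤ 3 → TermsSize (map litTerm (countedLits C)) ≤ 3 * suc k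
    countedTerms-size C len =
      ≤-trans (litTerms-size (countedLits C)) (*-monoˡ-≤ (suc k) (≤-trans (countedLits-length C) len))

    countForm-size : ∀ C → length C ≤ 3 → formSize (countForm C) ≤ A
    countForm-size C len = +-mono-≤ (countedTerms-size C len) (small-pos (countOffset-≤ C len))

    shiftForm-size : ∀ j C → j ≤ 3 → length C ≤ 3 → formSize (shiftForm j C) ≤ A
    shiftForm-size j C j≤3 len = +-mono-≤ (countedTerms-size C len) (diff-size (countOffset-≤ C len) j≤3)

    constForm-size : ∀ j → j ≤ 3 → formSize (constForm j) ≤ A
    constForm-size j j≤3 = ≤-trans (small-pos j≤3) (m≤n+m _ _)

    zeroForm-size : formSize zeroForm ≤ A
    zeroForm-size = ≤-trans (small-pos z≤n) (m≤n+m _ _)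

    K : ℕ
    K = suc (21 * A)

  module Refutations (nonzero : ∀ t → 0 < t → t ≤ 3 → ¬ (t ·1 ≈ 0#)) (φ : CNF) (φ-3cnf : Is3CNF φ) where
    open Semantics nonzero

    Φ : List LClause
    Φ = toLin φ

    hyp-valid : ∀ {s X C} → C ∈ φ → ValidLine s Φ X (toLClause C , hyp)
    hyp-valid C∈φ = Any.map⁺ (Any.map (λ { refl → ≈C-refl _ }) C∈φ)

    -- The lines following the hypothesis C in its segment, given the position i of the
    -- line  countForm C ∷ rest  and the clause rest.
    Derivation : Set c
    Derivation = ℕ → BClause → LClause → List Line

    -- A segment for each clause C of ψ: the hypothesis C, then d lines deriving rest from
    -- countForm C ∷ rest (at position i), where rest = {countForm D = 0 : D after C}.
    chain : Derivation → ℕ → ℕ → List BClause → List Line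
    chain der d i []      = []
    chain der d i (C ∷ ψ) = (toLClause C , hyp) ∷ der i C (map countForm ψ) ++ chain der d (d + suc i) ψ

    chain-valid : ∀ {s der d} →
      (∀ X {i C rest} → C ∈ φ → At X i (countForm C ∷ rest) → Cursor X (suc i) (toLClause C) →
         ValidFrom s Φ X (der i C rest)) →
      (∀ i C rest → length (der i C rest) ≡ d × At ((toLClause C , hyp) ∷ der i C rest) d rest) →
      ∀ {X i} ψ → All (_∈ φ) ψ → Cursor X i (map countForm ψ) →
      ValidFrom s Φ X (chain der d i ψ) × ∃[ j ] Cursor (X ++ chain der d i ψ) j []
    chain-valid _ _ {X} {i} [] [] cur = _ , i , ≡.subst (λ Z → Cursor Z i []) (≡.sym (++-identityʳ X)) cur
    chain-valid {s} {der} {d} der-valid der-end {X} {i} (C ∷ ψ) (C∈φ ∷ ψ⊆φ) cur =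
      finish (chain-valid der-valid der-end ψ ψ⊆φ segment-end)
      where
      h : Line
      h = (toLClause C , hyp)
      rest : LClause
      rest = map countForm ψ
      segment tail : List Line
      segment = h ∷ der i C rest
      tail = chain der d (d + suc i) ψ
      segment-end : Cursor (X ++ segment) (d + suc i) rest
      segment-end = cursor-++ X segment cur (proj₂ (der-end i C rest)) (≡.cong suc (proj₁ (der-end i C rest)))
      finish : ValidFrom s Φ (X ++ segment) tail × ∃[ j ] Cursor ((X ++ segment) ++ tail) j [] →
               ValidFrom s Φ X (segment ++ tail) × ∃[ j ] Cursor (X ++ (segment ++ tail)) j []
      finish (tail-valid , j , tail-end) =
        (hyp-valid {s} {X} C∈φ ,
         validFrom-++ (X ++ h ∷ []) (der i C rest) tail
           (der-valid (X ++ h ∷ []) C∈φ (at-++ˡ X (proj₂ cur)) (cursor-++ X (h ∷ []) cur refl refl))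
           (≡.subst (λ Z → ValidFrom s Φ Z tail) (≡.sym (++-assoc X (h ∷ []) (der i C rest))) tail-valid)) ,
        j , ≡.subst (λ Z → Cursor Z j []) (++-assoc X segment tail) tail-end

    length≤3 : ∀ {C} → C ∈ φ → length C ≤ 3
    length≤3 = All.lookup φ-3cnf

    -- Semantic resolution: from  countForm C ∷ rest  and the hypothesis C, derive rest,
    -- since the counting form of a satisfied clause does not vanish.
    semDerivation : Derivation
    semDerivation i C rest = (rest , rule2 i (suc i)) ∷ []

    semDerivation-valid : ∀ X {i C rest} → C ∈ φ → At X i (countForm C ∷ rest) →
                          Cursor X (suc i) (toLClause C) → ValidFrom sem Φ X (semDerivation i C rest)
    semDerivation-valid X {C = C} {rest} C∈φ atN (_ , atC) = (_ , _ , atN , atC , resolve) , _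
      where
      resolve : (countForm C ∷ rest) ∧ toLClause C ⊨ rest
      resolve a (here N≈0) satC = ⊥-elim (countForm-sat a C (length≤3 C∈φ) (toLClause-sound a C satC) N≈0)
      resolve a (there satRest) _ = satRest

    -- Resolution + weakening: weaken the hypothesis C to the three shift forms of C; then
    -- eliminate them one at a time.
    --   Eliminating g = countForm C − k from the last line  g ∷ Ds ++ rest  (at m): resolve
    --   with  countForm C ∷ rest  (at i) to  k = 0 ∨ rest ∨ Ds ∨ rest, then weaken away the
    --   false equation k = 0 and the repeated rest.
    eliminate : ℕ → ℕ → ℕ → LClause → LClause → List Line
    eliminate i m k Ds rest = (constForm k ∷ rest ++ (Ds ++ rest) , rule2 i m) ∷ (Ds ++ rest , rule1 (suc m)) ∷ []

    eliminate-valid : ∀ X k C Ds {i m rest} → 0 < k → k ≤ 3 → At X i (countForm C ∷ rest) →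
                      Cursor X m (shiftForm k C ∷ Ds ++ rest) → ValidFrom sw Φ X (eliminate i m k Ds rest)
    eliminate-valid X k C Ds {i} {m} {rest} 0<k k≤3 atN cur@(_ , atG) =
      (_ , _ , atN , atG , resolution) ,
      (_ , proj₂ (cursor-++ X (l ∷ []) cur refl refl) ,
       weaken-drop (constForm k) rest Ds (λ a → constForm-false a k 0<k k≤3)) ,
      _
      where
      l : Line
      l = (constForm k ∷ rest ++ (Ds ++ rest) , rule2 i m)
      resolution : ResolutionStep (countForm C ∷ rest) (shiftForm k C ∷ Ds ++ rest)
                                  (constForm k ∷ rest ++ (Ds ++ rest))
      resolution = _ , _ , _ , _ , 1# , ⊝ 1# , _ , ≈C-refl _ , ≈C-refl _ , shiftForm-comb k C , ≈C-refl _

    -- Positions: the hypothesis C at i+1, the weakened line at i+2, then the three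
    -- eliminations at i+3 … i+8, the last of which is rest.
    swDerivation : Derivation
    swDerivation i C rest =
      (shiftForms C ++ rest , rule1 (suc i)) ∷
      eliminate i (2 + i) 1 (shiftForm 2 C ∷ shiftForm 3 C ∷ []) rest ++
      eliminate i (4 + i) 2 (shiftForm 3 C ∷ []) rest ++
      eliminate i (6 + i) 3 [] rest

    swDerivation-valid : ∀ X {i C rest} → C ∈ φ → At X i (countForm C ∷ rest) →
                         Cursor X (suc i) (toLClause C) → ValidFrom sw Φ X (swDerivation i C rest)
    swDerivation-valid X {i} {C} {rest} C∈φ atN cur =
      (_ , proj₂ cur , weaken) ,
      validFrom-++ {sw} {Φ} X₁ e₁ (e₂ ++ e₃) valid₁
        (validFrom-++ {sw} {Φ} (X₁ ++ e₁) e₂ e₃ valid₂ valid₃)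
      where
      weaken : toLClause C ⊨ (shiftForms C ++ rest)
      weaken a sat = Any.++⁺ˡ (shiftForms-cover a C (length≤3 C∈φ) (toLClause-sound a C sat))
      g : Line
      g = (shiftForms C ++ rest , rule1 (suc i))
      X₁ e₁ e₂ e₃ : List Line
      X₁ = X ++ g ∷ []
      e₁ = eliminate i (2 + i) 1 (shiftForm 2 C ∷ shiftForm 3 C ∷ []) rest
      e₂ = eliminate i (4 + i) 2 (shiftForm 3 C ∷ []) rest
      e₃ = eliminate i (6 + i) 3 [] rest
      atN₁ : At X₁ i (countForm C ∷ rest)
      atN₁ = at-++ˡ X atN
      atN₂ : At (X₁ ++ e₁) i (countForm C ∷ rest)
      atN₂ = at-++ˡ X₁ atN₁
      atN₃ : At ((X₁ ++ e₁) ++ e₂) i (countForm C ∷ rest)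
      atN₃ = at-++ˡ (X₁ ++ e₁) atN₂
      cur₁ : Cursor X₁ (2 + i) (shiftForm 1 C ∷ (shiftForm 2 C ∷ shiftForm 3 C ∷ []) ++ rest)
      cur₁ = cursor-++ X (g ∷ []) cur refl refl
      cur₂ : Cursor (X₁ ++ e₁) (4 + i) (shiftForm 2 C ∷ (shiftForm 3 C ∷ []) ++ rest)
      cur₂ = cursor-++ X₁ e₁ cur₁ refl refl
      cur₃ : Cursor ((X₁ ++ e₁) ++ e₂) (6 + i) (shiftForm 3 C ∷ [] ++ rest)
      cur₃ = cursor-++ (X₁ ++ e₁) e₂ cur₂ refl refl
      valid₁ : ValidFrom sw Φ X₁ e₁
      valid₁ = eliminate-valid X₁ 1 C (shiftForm 2 C ∷ shiftForm 3 C ∷ []) (s≤s z≤n) (s≤s z≤n) atN₁ cur₁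
      valid₂ : ValidFrom sw Φ (X₁ ++ e₁) e₂
      valid₂ = eliminate-valid (X₁ ++ e₁) 2 C (shiftForm 3 C ∷ []) (s≤s z≤n) (s≤s (s≤s z≤n)) atN₂ cur₂
      valid₃ : ValidFrom sw Φ ((X₁ ++ e₁) ++ e₂) e₃
      valid₃ = eliminate-valid ((X₁ ++ e₁) ++ e₂) 3 C [] (s≤s z≤n) ≤-refl atN₃ cur₃

    chain-wf : ∀ {der d} → (∀ i C rest → All WFForm rest → All (λ l → WFClause (proj₁ l)) (der i C rest)) →
               ∀ i ψ → All (λ l → WFClause (proj₁ l)) (chain der d i ψ)
    chain-wf der-wf i []      = []
    chain-wf der-wf i (C ∷ ψ) = toLClause-wf C ∷ All.++⁺ (der-wf i C _ (countForms-wf ψ)) (chain-wf der-wf _ ψ)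

    semDerivation-wf : ∀ i C rest → All WFForm rest → All (λ l → WFClause (proj₁ l)) (semDerivation i C rest)
    semDerivation-wf i C rest rest-wf = rest-wf ∷ []

    swDerivation-wf : ∀ i C rest → All WFForm rest → All (λ l → WFClause (proj₁ l)) (swDerivation i C rest)
    swDerivation-wf i C rest rest-wf =
      All.++⁺ (shift-wf 1 ∷ shift-wf 2 ∷ shift-wf 3 ∷ []) rest-wf ∷
      All.++⁺ (eliminate-wf (2 + i) 1 (shift-wf 2 ∷ shift-wf 3 ∷ []))
        (All.++⁺ (eliminate-wf (4 + i) 2 (shift-wf 3 ∷ [])) (eliminate-wf (6 + i) 3 []))
      where
      shift-wf : ∀ k → WFForm (shiftForm k C)
      shift-wf k = shiftForm-wf k C
      eliminate-wf : ∀ m k {Ds} → All WFForm Ds → All (λ l → WFClause (proj₁ l)) (eliminate i m k Ds rest)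
      eliminate-wf m k Ds-wf = ([] ∷ All.++⁺ rest-wf (All.++⁺ Ds-wf rest-wf)) ∷ All.++⁺ Ds-wf rest-wf ∷ []

    trivialRefutation : ∀ {s} → [] ∈ φ → Refutation s Φ (([] , hyp) ∷ [])
    trivialRefutation {s} []∈φ = [] ∷ [] , (hyp-valid {s} {[]} []∈φ , _) , refl

    zeroClause : LClause
    zeroClause = zeroForm ∷ []

    swRefutation : List Line
    swRefutation = (zeroClause , axm) ∷ (map countForm φ , rule1 0) ∷ chain swDerivation 7 1 φ

    semRefutation : List Line
    semRefutation =
      (zeroClause , axm) ∷ (zeroClause , axm) ∷ (map countForm φ , rule2 0 1) ∷ chain semDerivation 1 2 φ

    φ⊆φ : All (_∈ φ) φ
    φ⊆φ = All.tabulate (λ C∈φ → C∈φ)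

    swRefutation-correct : Unsatisfiable φ → Refutation sw Φ swRefutation
    swRefutation-correct unsat
      with chain-valid swDerivation-valid (λ _ _ _ → refl , refl)
                       {X = (zeroClause , axm) ∷ (map countForm φ , rule1 0) ∷ []} φ φ⊆φ (refl , refl)
    ... | chain-ok , _ , ends-empty =
      ([] ∷ []) ∷ countForms-wf φ ∷ chain-wf swDerivation-wf 1 φ ,
      (≈C-refl _ , (_ , refl , λ a _ → unsat-countForms φ unsat a) , chain-ok) ,
      cursor-last swRefutation ends-empty

    semRefutation-correct : Unsatisfiable φ → Refutation sem Φ semRefutation
    semRefutation-correct unsat
      with chain-valid semDerivation-valid (λ _ _ _ → refl , refl)
                       {X = (zeroClause , axm) ∷ (zeroClause , axm) ∷ (map countForm φ , rule2 0 1) ∷ []}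
                       φ φ⊆φ (refl , refl)
    ... | chain-ok , _ , ends-empty =
      ([] ∷ []) ∷ ([] ∷ []) ∷ countForms-wf φ ∷ chain-wf semDerivation-wf 2 φ ,
      (≈C-refl _ , ≈C-refl _ , (_ , _ , refl , refl , λ a _ _ → unsat-countForms φ unsat a) , chain-ok) ,
      cursor-last semRefutation ends-empty

    -- In the semantic-resolution refutation the premises are 0, 1, 2, …, each used once.
    semRefutation-treeLike : TreeLike semRefutation
    semRefutation-treeLike = consecutive-once (next (next (chain-consecutive 2 φ)))
      where
      chain-consecutive : ∀ i ψ → Consecutive i (allPremises (chain semDerivation 1 i ψ))
      chain-consecutive i []      = done
      chain-consecutive i (C ∷ ψ) = next (next (chain-consecutive (2 + i) ψ))

    -- Size of the refutations: O(|φ|) lines, each with O(|φ|) forms of constant size.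
    module ProofSize (csize : Carrier → ℕ) (k : ℕ) (intSize : IntSizeBound csize k) where
      open Size csize
      open FormSizes csize k intSize

      M : ℕ
      M = length φ

      S : ℕ
      S = setSize Φ

      L : ℕ
      L = 3 + (M + M)

      B : ℕ
      B = L * A

      Small : LClause → Set c
      Small = All (λ f → formSize f ≤ A)

      Fits : LClause → Set c
      Fits C = Small C × length C ≤ L

      clauseSize-≤ : ∀ {C} → Small C → clauseSize C ≤ length C * A
      clauseSize-≤ []       = z≤n
      clauseSize-≤ (p ∷ ps) = +-mono-≤ p (clauseSize-≤ ps)

      derived-size : ∀ ls → All (λ l → Fits (proj₁ l)) ls → proofSize ls ≤ length ls * B
      derived-size []       []                    = z≤n
      derived-size (l ∷ ls) ((small , len) ∷ fit) =
        +-mono-≤ (≤-trans (clauseSize-≤ small) (*-monoˡ-≤ A len)) (derived-size ls fit)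

      proofSize-++ : ∀ xs ys → proofSize (xs ++ ys) ≡ proofSize xs + proofSize ys
      proofSize-++ xs ys = ≡.trans (≡.cong sum (map-++ size xs ys)) (sum-++ (map size xs) (map size ys))
        where
        size : Line → ℕ
        size l = clauseSize (proj₁ l)

      countForms-small : ∀ {ψ} → All (λ C → length C ≤ 3) ψ → Small (map countForm ψ)
      countForms-small ψ-3cnf = All.map⁺ (All.map (λ {C} → countForm-size C) ψ-3cnf)

      DerivationFits : Derivation → ℕ → Set c
      DerivationFits der d = ∀ i C rest → length C ≤ 3 → length rest ≤ M → Small rest →
        All (λ l → Fits (proj₁ l)) (der i C rest) × length (der i C rest) ≡ d

      chain-size : ∀ {der d} →
        DerivationFits der d →
        ∀ i ψ → length ψ ≤ M → All (λ C → length C ≤ 3) ψ →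
        proofSize (chain der d i ψ) ≤ setSize (toLin ψ) + length ψ * (d * B)
      chain-size der-fits i []      _    _              = z≤n
      chain-size {der} {d} der-fits i (C ∷ ψ) lenCψ (C-3 ∷ ψ-3cnf) =
        ≤-trans (≤-reflexive (≡.cong (h +_) (proofSize-++ (der i C rest) tail)))
          (≤-trans (+-monoʳ-≤ h (+-mono-≤ der-size (chain-size der-fits (d + suc i) ψ lenψ ψ-3cnf)))
                   (≤-reflexive (regroupℕ h (d * B) (setSize (toLin ψ)) (length ψ * (d * B)))))
        where
        h : ℕ
        h = clauseSize (toLClause C)
        rest : LClause
        rest = map countForm ψ
        tail : List Line
        tail = chain der d (d + suc i) ψ
        lenψ : length ψ ≤ M
        lenψ = ≤-trans (n≤1+n _) lenCψ
        fits : All (λ l → Fits (proj₁ l)) (der i C rest) × length (der i C rest) ≡ d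
        fits = der-fits i C rest C-3 (≤-trans (≤-reflexive (length-map countForm ψ)) lenψ) (countForms-small ψ-3cnf)
        der-size : proofSize (der i C rest) ≤ d * B
        der-size = ≤-trans (derived-size _ (proj₁ fits)) (≤-reflexive (≡.cong (_* B) (proj₂ fits)))
        regroupℕ : ∀ h x s y → h + (x + (s + y)) ≡ (h + s) + (x + y)
        regroupℕ = solve-∀

      ≤-via : ∀ {x y} z → x + z ≡ y → x ≤ y
      ≤-via {x} z x+z≡y = ≤-trans (m≤m+n x z) (≤-reflexive x+z≡y)

      M≤L : M ≤ L
      M≤L = ≤-trans (m≤m+n M M) (m≤n+m _ 3)

      -- Each derivation's lines have at most 3 + 2·|rest| ≤ L small forms.
      semDerivation-fits : DerivationFits semDerivation 1
      semDerivation-fits i C rest _ r≤M small = ((small , ≤-trans r≤M M≤L) ∷ []) , refl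

      swDerivation-fits : DerivationFits swDerivation 7
      swDerivation-fits i C rest C-3 r≤M small =
        ((All.++⁺ (sf 1 1≤3 ∷ sf 2 2≤3 ∷ sf 3 ≤-refl ∷ []) small , +-monoʳ-≤ 3 (≤-trans r≤M (m≤m+n M M))) ∷
          All.++⁺ (eliminate-fits (2 + i) 1 1≤3 (sf 2 2≤3 ∷ sf 3 ≤-refl ∷ []) ≤-refl)
            (All.++⁺ (eliminate-fits (4 + i) 2 2≤3 (sf 3 ≤-refl ∷ []) (s≤s z≤n))
                     (eliminate-fits (6 + i) 3 ≤-refl [] z≤n))) ,
        refl
        where
        1≤3 : 1 ≤ 3
        1≤3 = s≤s z≤n
        2≤3 : 2 ≤ 3
        2≤3 = s≤s (s≤s z≤n)
        sf : ∀ j → j ≤ 3 → formSize (shiftForm j C) ≤ A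
        sf j j≤3 = shiftForm-size j C j≤3 C-3
        eliminate-fits : ∀ m j {Ds} → j ≤ 3 → Small Ds → length Ds ≤ 2 →
                         All (λ l → Fits (proj₁ l)) (eliminate i m j Ds rest)
        eliminate-fits m j {Ds} j≤3 Ds-small Ds≤2 =
          (constForm-size j j≤3 ∷ All.++⁺ small (All.++⁺ Ds-small small) , resolvent-length) ∷
          (All.++⁺ Ds-small small , weakened-length) ∷ []
          where
          resolvent-length : suc (length (rest ++ (Ds ++ rest))) ≤ L
          resolvent-length = ≤-trans
            (s≤s (≤-trans (≤-reflexive (≡.trans (length-++ rest) (≡.cong (length rest +_) (length-++ Ds))))
                          (+-mono-≤ r≤M (+-mono-≤ Ds≤2 r≤M))))
            (≤-reflexive (sum-shape M))
            where
            sum-shape : ∀ M → suc (M + (2 + M)) ≡ 3 + (M + M)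
            sum-shape = solve-∀
          weakened-length : length (Ds ++ rest) ≤ L
          weakened-length = ≤-trans (≤-reflexive (length-++ Ds))
            (≤-trans (+-mono-≤ Ds≤2 r≤M) (≤-trans (n≤1+n (2 + M)) (+-monoʳ-≤ 3 (m≤m+n M M))))

      clauses≤size : ∀ ψ → All (λ C → 0 < length C) ψ → length ψ ≤ setSize (toLin ψ)
      clauses≤size []                       []       = z≤n
      clauses≤size (((_ , true)  ∷ _) ∷ ψ) (_ ∷ ne) = +-mono-≤ (s≤s z≤n) (clauses≤size ψ ne)
      clauses≤size (((_ , false) ∷ _) ∷ ψ) (_ ∷ ne) = +-mono-≤ (s≤s z≤n) (clauses≤size ψ ne)

      -- Both refutations: at most 3 opening lines, then a chain with at most 7 lines per clause.
      Total : ℕ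
      Total = 3 * B + (S + M * (7 * B))

      refutation-size : ∀ opening {der d} i → All (λ l → Fits (proj₁ l)) opening → length opening ≤ 3 →
                        d ≤ 7 → DerivationFits der d → proofSize (opening ++ chain der d i φ) ≤ Total
      refutation-size opening {der} {d} i fits opening≤3 d≤7 der-fits =
        ≤-trans (≤-reflexive (proofSize-++ opening (chain der d i φ)))
          (+-mono-≤ (≤-trans (derived-size opening fits) (*-monoˡ-≤ B opening≤3))
                    (≤-trans (chain-size der-fits i φ ≤-refl φ-3cnf)
                             (+-monoʳ-≤ S (*-monoʳ-≤ M (*-monoˡ-≤ B d≤7)))))

      zeroClause-fits : Fits zeroClause
      zeroClause-fits = zeroForm-size ∷ [] , s≤s z≤n

      countForms-fits : Fits (map countForm φ)
      countForms-fits = countForms-small φ-3cnf , ≤-trans (≤-reflexive (length-map countForm φ)) M≤L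

      swRefutation-size : proofSize swRefutation ≤ Total
      swRefutation-size =
        refutation-size ((zeroClause , axm) ∷ (map countForm φ , rule1 0) ∷ []) 1
                        (zeroClause-fits ∷ countForms-fits ∷ []) (s≤s (s≤s z≤n)) ≤-refl swDerivation-fits

      semRefutation-size : proofSize semRefutation ≤ Total
      semRefutation-size =
        refutation-size ((zeroClause , axm) ∷ (zeroClause , axm) ∷ (map countForm φ , rule2 0 1) ∷ []) 2
                        (zeroClause-fits ∷ zeroClause-fits ∷ countForms-fits ∷ [])
                        ≤-refl (s≤s z≤n) semDerivation-fits

      total-bound : M ≤ S → Total ≤ K * suc S ^ 2
      total-bound M≤S =
        ≤-trans (≤-reflexive (expand S M A))
          (≤-trans (+-mono-≤ (≤-trans (n≤1+n S) (m≤m*n (suc S) (suc S)))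
                             (*-mono-≤ lines≤ (*-monoˡ-≤ A width≤)))
                   (≤-reflexive (collect (suc S) A)))
        where
        expand : ∀ S M A → 3 * ((3 + (M + M)) * A) + (S + M * (7 * ((3 + (M + M)) * A)))
                           ≡ S + (3 + 7 * M) * ((3 + (M + M)) * A)
        expand = solve-∀
        collect : ∀ s A → s * s + (7 * s) * ((3 * s) * A) ≡ suc (21 * A) * (s * (s * 1))
        collect = solve-∀
        lines≤ : 3 + 7 * M ≤ 7 * suc S
        lines≤ = ≤-trans (+-mono-≤ {3} {7} (s≤s (s≤s (s≤s z≤n))) (*-monoʳ-≤ 7 M≤S)) (≤-reflexive (seven S))
          where
          seven : ∀ S → 7 + 7 * S ≡ 7 * suc S
          seven = solve-∀
        width≤ : 3 + (M + M) ≤ 3 * suc S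
        width≤ = ≤-trans (+-monoʳ-≤ 3 (+-mono-≤ M≤S M≤S)) (≤-via S (three S))
          where
          three : ∀ S → 3 + (S + S) + S ≡ 3 * suc S
          three = solve-∀

  emptyClause? : ∀ (φ : CNF) → [] ∈ φ ⊎ All (λ C → 0 < length C) φ
  emptyClause? φ with All.all? (λ C → 1 ≤? length C) φ
  ... | yes nonempty = inj₂ nonempty
  ... | no  ¬nonempty = inj₁ (Any.map empty (All.¬All⇒Any¬ (λ C → 1 ≤? length C) φ ¬nonempty))
    where
    empty : ∀ {C : BClause} → ¬ (0 < length C) → [] ≡ C
    empty {[]}    _     = refl
    empty {_ ∷ _} ¬0<len = ⊥-elim (¬0<len (s≤s z≤n))

  module Bounds (nonzero : ∀ t → 0 < t → t ≤ 3 → ¬ (t ·1 ≈ 0#)) (csize : Carrier → ℕ)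
                (bin : BinaryIntSize csize) where
    open Size csize
    open FormSizes csize (proj₁ bin) (proj₂ bin) using (K)

    sw-polyBounded : PolyBounded sw false
    sw-polyBounded = K , 2 , refute
      where
      refute : ∀ φ → Is3CNF φ → Unsatisfiable φ → Σ (List Line) λ π → Refutation sw (toLin φ) π
                 × Data.Unit.Polymorphic.⊤ × proofSize π ≤ K * suc (setSize (toLin φ)) ^ 2
      refute φ φ-3cnf unsat with emptyClause? φ
      ... | inj₁ []∈φ     = _ , trivialRefutation {sw} []∈φ , _ , z≤n
        where open Refutations nonzero φ φ-3cnf
      ... | inj₂ nonempty = swRefutation , swRefutation-correct unsat , _ ,
                            ≤-trans swRefutation-size (total-bound (clauses≤size φ nonempty))
        where open Refutations nonzero φ φ-3cnf
              open ProofSize csize (proj₁ bin) (proj₂ bin)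

    sem-polyBounded : PolyBounded sem true
    sem-polyBounded = K , 2 , refute
      where
      refute : ∀ φ → Is3CNF φ → Unsatisfiable φ → Σ (List Line) λ π → Refutation sem (toLin φ) π
                 × TreeLike π × proofSize π ≤ K * suc (setSize (toLin φ)) ^ 2
      refute φ φ-3cnf unsat with emptyClause? φ
      ... | inj₁ []∈φ     = _ , trivialRefutation {sem} []∈φ , (λ _ → z≤n) , z≤n
        where open Refutations nonzero φ φ-3cnf
      ... | inj₂ nonempty = semRefutation , semRefutation-correct unsat , semRefutation-treeLike ,
                            ≤-trans semRefutation-size (total-bound (clauses≤size φ nonempty))
        where open Refutations nonzero φ φ-3cnf
              open ProofSize csize (proj₁ bin) (proj₂ bin)

mainTheorem17 : ∀ {c ℓ : Level} (R : Ring c ℓ) →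
    (∀ n → LinR.CharIs R n → (n ≢ 1) × (n ≢ 2) × (n ≢ 3)) →
    (csize : Ring.Carrier R → ℕ) → LinR.BinaryIntSize R csize →
    LinR.Size.PolyBounded R csize LinR.sw false
      × LinR.Size.PolyBounded R csize LinR.sem true
mainTheorem17 R char∉123 csize intSize = sw-polyBounded , sem-polyBounded
  where open Bounds R (smallMultiples-nonzero R char∉123) csize intSize
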